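{- Let $n,k$ be integers with $k\ge1$, $n>2k$. Then $\beta(P(n,k))=n+1$ if and only if either $n$ is odd and $k=1$, or $(n,k)=(5,2)$.
   Context: $P(n,k)$ is the generalized Petersen graph with vertices $u_1,\dots,u_n,v_1,\dots,v_n$ and edges $u_iu_{i+1}$, $u_iv_i$, $v_iv_{i+k}$ (subscripts modulo $n$). $\beta(G)$ denotes the size of a minimum vertex cover of $G$. -}

module Defs where

open import Data.Nat using (ℕ; suc; _+_; _%_; _≤_)
open import Data.Nat.DivMod using (m%n<n)
open import Data.Fin using (Fin; toℕ; fromℕ<)
open import Data.Fin.Subset using (Subset; _∈_; ∣_∣)
open import Data.Sum using (_⊎_)
open import Data.Product using (_×_; Σ; _,_)
open import Relation.Binary.PropositionalEquality using (_≡_)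

_⊕_ : {n : ℕ} → Fin n → ℕ → Fin n
_⊕_ {suc n} i j = fromℕ< (m%n<n (toℕ i + j) (suc n))

-- A vertex set of P(n,k) is a pair (U , V) with U ⊆ {u_0..u_{n-1}},
-- V ⊆ {v_0..v_{n-1}}.
PSet : ℕ → Set
PSet n = Subset n × Subset n

size : {n : ℕ} → PSet n → ℕ
size (U , V) = ∣ U ∣ + ∣ V ∣

-- (U , V) is a vertex cover of P(n,k): every edge u_i u_{i+1}, u_i v_i,
-- v_i v_{i+k} (subscripts mod n) has an endpoint in the set.
IsVertexCover : (n k : ℕ) → PSet n → Set
IsVertexCover n k (U , V) =
  (i : Fin n) →
    (i ∈ U ⊎ (i ⊕ 1) ∈ U)
    × (i ∈ U ⊎ i ∈ V)
    × (i ∈ V ⊎ (i ⊕ k) ∈ V)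

VertexCoverNumber : (n k m : ℕ) → Set
VertexCoverNumber n k m =
  Σ (PSet n) (λ C → IsVertexCover n k C × size C ≡ m)
  × ((C : PSet n) → IsVertexCover n k C → m ≤ size C)

Odd : ℕ → Set
Odd n = n % 2 ≡ 1

module Submission where

-- Every cover contains an end of each of the n disjoint spokes u_i v_i, so by inclusion–
-- exclusion its size is n plus the number of doubled spokes (both ends taken): β ≥ n, and
-- β ≥ n + 1 whenever there is no exact cover (one end per spoke).  For "⇒" with k ≥ 2, a cover of size n + 1 has one doubled spoke i₀ and
-- w j = [u_{i₀+j} ∈ C] satisfies PathConstraints; squares of outer and inner edges force w to
-- alternate and to repeat itself at distance k, which is contradictory for k even or for n
-- odd, k ≥ 3.  What remains is (5,2) or the bipartite case n even, k odd, where β = n.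

open import Defs
open import Data.Nat using (ℕ; zero; suc; _+_; _*_; _∸_; _≤_; _<_; z≤n; s≤s; _%_; _<?_; NonZero)
open import Data.Nat.Properties
open import Data.Nat.DivMod using (m%n<n; m<n⇒m%n≡m; %-distribˡ-+; m%n%n≡m%n; [m+n]%n≡m%n;
  m≤n⇒[n∸m]%m≡n%m; n%n≡0; m∣n⇒o%n%m≡o%m)
open import Data.Nat.Divisibility using (_∣_; m%n≡0⇒n∣m)
open import Data.Nat.Tactic.RingSolver using (solve-∀)
open import Data.Bool using (Bool; true; false; not; _∨_; _xor_; if_then_else_)
open import Data.Bool.Properties using (not-involutive; not-distribˡ-xor; not-distribʳ-xor;
  xor-identityʳ; ∨-inverseʳ; ∨-zeroʳ; not-¬)
open import Data.Vec using ([]; _∷_; lookup; tabulate)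
open import Data.Vec.Properties using (lookup∘tabulate; tabulate-∘; []=⇒lookup; lookup⇒[]=)
open import Data.Fin using (Fin; zero; suc; toℕ; fromℕ<)
open import Data.Fin.Properties using (toℕ-fromℕ<; toℕ-injective; toℕ<n)
open import Data.Fin.Subset using (Subset; _∈_; _∉_; ∣_∣; _∩_; _∪_; ∁; _-_; ⊤)
open import Data.Fin.Subset.Properties using (∣⊤∣≡n; ∣p∣≤n; p⊆q⇒∣p∣≤∣q∣; ∣∁p∣≡n∸∣p∣;
  x∈p∪q⁺; x∈p∩q⁺; x∈p⇒∣p-x∣<∣p∣; x∈p∧x≢y⇒x∈p-y; nonempty?; Empty-unique; ∣⊥∣≡0)
open import Data.Product using (_×_; Σ; ∃; _,_; proj₁; proj₂)
open import Data.Sum using (_⊎_; inj₁; inj₂)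
open import Data.Empty using (⊥; ⊥-elim)
open import Function using (_∘_)
open import Function.Bundles using (_⇔_; mk⇔; Equivalence)
open import Relation.Nullary using (yes; no; contradiction)
open import Relation.Binary.PropositionalEquality

-- Parity is a Boolean, so that alternation along a path reads w (1 + d) = odd d xor w 1.
odd : ℕ → Bool
odd zero = false
odd (suc n) = not (odd n)

odd-+ : ∀ m n → odd (m + n) ≡ odd n xor odd m
odd-+ zero n = sym (xor-identityʳ (odd n))
odd-+ (suc m) n = trans (cong not (odd-+ m n)) (not-distribʳ-xor (odd n) (odd m))

odd-double : ∀ n → odd (2 * n) ≡ false
odd-double zero = refl
odd-double (suc n) = trans (cong (not ∘ odd) (+-suc n (n + 0))) (cong (not ∘ not) (odd-double n))

odd-double+ : ∀ n r → odd (2 * n + r) ≡ odd r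
odd-double+ n r = trans (odd-+ (2 * n) r) (trans (cong (odd r xor_) (odd-double n)) (xor-identityʳ (odd r)))

%2≡odd : ∀ n → n % 2 ≡ (if odd n then 1 else 0)
%2≡odd zero = refl
%2≡odd (suc zero) = refl
%2≡odd (suc (suc n)) = trans (%2≡odd n) (cong (if_then 1 else 0) (sym (not-involutive (odd n))))

Odd⇔odd : ∀ n → Odd n ⇔ (odd n ≡ true)
Odd⇔odd n = mk⇔ to from
  where
  to : n % 2 ≡ 1 → odd n ≡ true
  to h with odd n | %2≡odd n
  ... | true | _ = refl
  ... | false | e = contradiction (trans (sym h) e) (λ ())
  from : odd n ≡ true → n % 2 ≡ 1
  from h = trans (%2≡odd n) (cong (if_then 1 else 0) h)

odd-mod-even : ∀ {n} .{{_ : NonZero n}} → odd n ≡ false → ∀ x → odd (x % n) ≡ odd x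
odd-mod-even {n} even x = begin
  odd (x % n)         ≡⟨ parity-bit (x % n) ⟩
  odd (x % n % 2)     ≡⟨ cong odd (m∣n⇒o%n%m≡o%m 2 n x 2∣n) ⟩
  odd (x % 2)         ≡⟨ parity-bit x ⟨
  odd x               ∎
  where
  open ≡-Reasoning
  parity-bit : ∀ y → odd y ≡ odd (y % 2)
  parity-bit y with odd y | %2≡odd y
  ... | true | e = cong odd (sym e)
  ... | false | e = cong odd (sym e)
  2∣n : 2 ∣ n
  2∣n = m%n≡0⇒n∣m n 2 (trans (%2≡odd n) (cong (if_then 1 else 0) even))

exactly-one : ∀ {a b} → a ∨ b ≡ true → (a ≡ true → b ≡ true → ⊥) → b ≡ not a
exactly-one {true} {true} _ both = ⊥-elim (both refl refl)
exactly-one {true} {false} _ _ = refl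
exactly-one {false} {true} _ _ = refl
exactly-one {false} {false} () _

alternate : ∀ {a b} → a ∨ b ≡ true → not a ∨ not b ≡ true → b ≡ not a
alternate {true} {false} _ _ = refl
alternate {false} {true} _ _ = refl
alternate {true} {true} _ ()
alternate {false} {false} () _

∨-cong : ∀ {a b a' b'} → a ≡ a' → b ≡ b' → a' ∨ b' ≡ true → a ∨ b ≡ true
∨-cong refl refl h = h

∈⊎∈⇔∨ : ∀ {n} (p q : Subset n) i j → (i ∈ p ⊎ j ∈ q) ⇔ (lookup p i ∨ lookup q j ≡ true)
∈⊎∈⇔∨ p q i j = mk⇔ to from
  where
  to : i ∈ p ⊎ j ∈ q → lookup p i ∨ lookup q j ≡ true
  to (inj₁ i∈p) = cong (_∨ lookup q j) ([]=⇒lookup i∈p)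
  to (inj₂ j∈q) = trans (cong (lookup p i ∨_) ([]=⇒lookup j∈q)) (∨-zeroʳ (lookup p i))
  from : lookup p i ∨ lookup q j ≡ true → i ∈ p ⊎ j ∈ q
  from h with lookup p i in pi
  ... | true = inj₁ (lookup⇒[]= i p pi)
  ... | false = inj₂ (lookup⇒[]= j q h)

CoversAt : ∀ {n} → ℕ → Subset n → Subset n → Fin n → Set
CoversAt k U V i =
  (lookup U i ∨ lookup U (i ⊕ 1) ≡ true)
  × (lookup U i ∨ lookup V i ≡ true)
  × (lookup V i ∨ lookup V (i ⊕ k) ≡ true)

cover⇔ : ∀ {n k} (U V : Subset n) → IsVertexCover n k (U , V) ⇔ (∀ i → CoversAt k U V i)
cover⇔ {n} {k} U V = mk⇔ (λ cov i → covers-at i (cov i)) (λ cov i → edges-at i (cov i))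
  where
  open Equivalence
  EdgesAt : Fin n → Set
  EdgesAt i = (i ∈ U ⊎ (i ⊕ 1) ∈ U) × (i ∈ U ⊎ i ∈ V) × (i ∈ V ⊎ (i ⊕ k) ∈ V)
  covers-at : ∀ i → EdgesAt i → CoversAt k U V i
  covers-at i (o , s , r) =
    to (∈⊎∈⇔∨ U U i (i ⊕ 1)) o , to (∈⊎∈⇔∨ U V i i) s , to (∈⊎∈⇔∨ V V i (i ⊕ k)) r
  edges-at : ∀ i → CoversAt k U V i → EdgesAt i
  edges-at i (o , s , r) =
    from (∈⊎∈⇔∨ U U i (i ⊕ 1)) o , from (∈⊎∈⇔∨ U V i i) s , from (∈⊎∈⇔∨ V V i (i ⊕ k)) r

∣∪∣+∣∩∣ : ∀ {n} (p q : Subset n) → ∣ p ∪ q ∣ + ∣ p ∩ q ∣ ≡ ∣ p ∣ + ∣ q ∣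
∣∪∣+∣∩∣ [] [] = refl
∣∪∣+∣∩∣ (true ∷ p) (true ∷ q) = cong suc (trans (+-suc ∣ p ∪ q ∣ ∣ p ∩ q ∣)
  (trans (cong suc (∣∪∣+∣∩∣ p q)) (sym (+-suc ∣ p ∣ ∣ q ∣))))
∣∪∣+∣∩∣ (true ∷ p) (false ∷ q) = cong suc (∣∪∣+∣∩∣ p q)
∣∪∣+∣∩∣ (false ∷ p) (true ∷ q) = trans (cong suc (∣∪∣+∣∩∣ p q)) (sym (+-suc ∣ p ∣ ∣ q ∣))
∣∪∣+∣∩∣ (false ∷ p) (false ∷ q) = ∣∪∣+∣∩∣ p q

∀∈⇒∣p∣≡n : ∀ {n} (p : Subset n) → (∀ i → i ∈ p) → ∣ p ∣ ≡ n
∀∈⇒∣p∣≡n {n} p all = ≤-antisym (∣p∣≤n p) (subst (_≤ ∣ p ∣) (∣⊤∣≡n n) (p⊆q⇒∣p∣≤∣q∣ {p = ⊤} (λ {i} _ → all i)))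

-- A cover meets every spoke, so its size is n plus the number of doubled spokes U ∩ V.
cover-size : ∀ {n k} (U V : Subset n) → IsVertexCover n k (U , V) → size (U , V) ≡ n + ∣ U ∩ V ∣
cover-size {n} U V cov = begin
  ∣ U ∣ + ∣ V ∣               ≡⟨ ∣∪∣+∣∩∣ U V ⟨
  ∣ U ∪ V ∣ + ∣ U ∩ V ∣       ≡⟨ cong (_+ ∣ U ∩ V ∣) (∀∈⇒∣p∣≡n (U ∪ V) (λ i → x∈p∪q⁺ (proj₁ (proj₂ (cov i))))) ⟩
  n + ∣ U ∩ V ∣               ∎
  where open ≡-Reasoning

∈⇒0<∣p∣ : ∀ {n} {p : Subset n} {i} → i ∈ p → 0 < ∣ p ∣
∈⇒0<∣p∣ i∈p = ≤-trans (s≤s z≤n) (x∈p⇒∣p-x∣<∣p∣ i∈p)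

∣p∣≡1⇒singleton : ∀ {n} (p : Subset n) → ∣ p ∣ ≡ 1 → Σ (Fin n) λ i → i ∈ p × (∀ j → j ≢ i → j ∉ p)
∣p∣≡1⇒singleton {n} p size≡1 with nonempty? p
... | no empty = ⊥-elim (0≢1+n (trans (sym (∣⊥∣≡0 n)) (trans (cong ∣_∣ (sym (Empty-unique empty))) size≡1)))
... | yes (i , i∈p) = i , i∈p , only-i
  where
  p-i-empty : ∣ p - i ∣ ≤ 0
  p-i-empty = <⇒≤pred (subst (∣ p - i ∣ <_) size≡1 (x∈p⇒∣p-x∣<∣p∣ i∈p))
  only-i : ∀ j → j ≢ i → j ∉ p
  only-i j j≢i j∈p = <-irrefl refl (≤-trans (∈⇒0<∣p∣ (x∈p∧x≢y⇒x∈p-y j∈p j≢i)) p-i-empty)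

single-end : ∀ {n} (U V : Subset n) i → lookup U i ∨ lookup V i ≡ true → i ∉ U ∩ V →
  lookup V i ≡ not (lookup U i)
single-end U V i spoke not-doubled = exactly-one spoke
  (λ ui vi → not-doubled (x∈p∩q⁺ (lookup⇒[]= i U ui , lookup⇒[]= i V vi)))

Exact : ∀ {n} → Subset n → Subset n → Set
Exact U V = ∀ i → lookup V i ≡ not (lookup U i)

undoubled⇒exact : ∀ {n k} (U V : Subset n) → IsVertexCover n k (U , V) → ∣ U ∩ V ∣ ≡ 0 → Exact U V
undoubled⇒exact U V cov none i = single-end U V i (proj₁ (proj₂ (Equivalence.to (cover⇔ U V) cov i)))
  (λ doubled → <-irrefl refl (subst (0 <_) none (∈⇒0<∣p∣ doubled)))

no-exact⇒lower-bound : ∀ {n k} → (∀ U V → IsVertexCover n k (U , V) → Exact U V → ⊥) →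
  ∀ C → IsVertexCover n k C → n + 1 ≤ size C
no-exact⇒lower-bound {n} no-exact (U , V) cov with ∣ U ∩ V ∣ in doubled | cover-size U V cov
... | zero | _ = ⊥-elim (no-exact U V cov (undoubled⇒exact U V cov doubled))
... | suc _ | size≡ = subst (n + 1 ≤_) (sym size≡) (+-monoʳ-≤ n (s≤s z≤n))

-- pos x is the vertex index x modulo n = suc m; indices are read along ℕ and wrapped.
pos : ∀ {m} → ℕ → Fin (suc m)
pos {m} x = fromℕ< (m%n<n x (suc m))

toℕ-pos : ∀ {m} x → toℕ (pos {m} x) ≡ x % suc m
toℕ-pos {m} x = toℕ-fromℕ< (m%n<n x (suc m))

pos-⊕ : ∀ {m} x j → pos {m} x ⊕ j ≡ pos (x + j)
pos-⊕ {m} x j = toℕ-injective (begin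
  toℕ (pos x ⊕ j)             ≡⟨ toℕ-pos (toℕ (pos {m} x) + j) ⟩
  (toℕ (pos {m} x) + j) % n   ≡⟨ cong (λ t → (t + j) % n) (toℕ-pos x) ⟩
  (x % n + j) % n             ≡⟨ %-distribˡ-+ (x % n) j n ⟩
  (x % n % n + j % n) % n     ≡⟨ cong (λ t → (t + j % n) % n) (m%n%n≡m%n x n) ⟩
  (x % n + j % n) % n         ≡⟨ %-distribˡ-+ x j n ⟨
  (x + j) % n                 ≡⟨ toℕ-pos (x + j) ⟨
  toℕ (pos {m} (x + j))       ∎)
  where
  open ≡-Reasoning
  n : ℕ
  n = suc m

pos-periodic : ∀ {m} x → pos {m} (x + suc m) ≡ pos x
pos-periodic {m} x = toℕ-injective (trans (toℕ-pos (x + suc m)) (trans ([m+n]%n≡m%n x (suc m)) (sym (toℕ-pos x))))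

pos-offset-≢ : ∀ {m} (i : Fin (suc m)) {j} → 1 ≤ j → j < suc m → pos (toℕ i + j) ≢ i
pos-offset-≢ {m} i {suc j} _ j<n returns with toℕ i + suc j <? suc m
... | yes no-wrap = 0≢1+n (sym (+-cancelˡ-≡ (toℕ i) (suc j) 0
      (trans (sym (m<n⇒m%n≡m no-wrap)) (trans back (sym (+-identityʳ (toℕ i)))))))
  where
  back : (toℕ i + suc j) % suc m ≡ toℕ i
  back = trans (sym (toℕ-pos (toℕ i + suc j))) (cong toℕ returns)
... | no wraps = <-irrefl j≡n j<n
  where
  n s : ℕ
  n = suc m
  s = toℕ i + suc j
  n≤s : n ≤ s
  n≤s = ≮⇒≥ wraps
  s∸n<n : s ∸ n < n
  s∸n<n = +-cancelˡ-< n (s ∸ n) n (subst (_< n + n) (sym (m+[n∸m]≡n n≤s)) (+-mono-< (toℕ<n i) j<n))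
  s∸n≡i : s ∸ n ≡ toℕ i
  s∸n≡i = begin
    s ∸ n              ≡⟨ m<n⇒m%n≡m s∸n<n ⟨
    (s ∸ n) % n        ≡⟨ m≤n⇒[n∸m]%m≡n%m n≤s ⟩
    s % n              ≡⟨ toℕ-pos s ⟨
    toℕ (pos {m} s)    ≡⟨ cong toℕ returns ⟩
    toℕ i              ∎
    where open ≡-Reasoning
  j≡n : suc j ≡ n
  j≡n = +-cancelˡ-≡ (toℕ i) (suc j) n
    (trans (sym (m+[n∸m]≡n n≤s)) (trans (cong (n +_) s∸n≡i) (+-comm n (toℕ i))))

_at_ : ∀ {m} → Subset (suc m) → ℕ → Bool
S at x = lookup S (pos x)

at-periodic : ∀ {m} (S : Subset (suc m)) x → S at (x + suc m) ≡ S at x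
at-periodic S x = cong (lookup S) (pos-periodic x)

module CyclicCover {m k} (U V : Subset (suc m)) (cov : IsVertexCover (suc m) k (U , V)) where

  covers : ∀ x → CoversAt k U V (pos x)
  covers x = Equivalence.to (cover⇔ U V) cov (pos x)

  outer : ∀ x → U at x ∨ U at suc x ≡ true
  outer x = subst (λ t → U at x ∨ lookup U t ≡ true)
    (trans (pos-⊕ x 1) (cong pos (+-comm x 1))) (proj₁ (covers x))

  spoke : ∀ x → U at x ∨ V at x ≡ true
  spoke x = proj₁ (proj₂ (covers x))

  inner : ∀ x → V at x ∨ V at (x + k) ≡ true
  inner x = subst (λ t → V at x ∨ lookup V t ≡ true) (pos-⊕ x k) (proj₂ (proj₂ (covers x)))

∣p∣+∣∁p∣≡n : ∀ {n} (p : Subset n) → ∣ p ∣ + ∣ ∁ p ∣ ≡ n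
∣p∣+∣∁p∣≡n p = trans (cong (∣ p ∣ +_) (∣∁p∣≡n∸∣p∣ p)) (m+[n∸m]≡n (∣p∣≤n p))

∣tab∣+∣tab-not∣≡n : ∀ {n} (h : Fin n → Bool) → ∣ tabulate h ∣ + ∣ tabulate (not ∘ h) ∣ ≡ n
∣tab∣+∣tab-not∣≡n h = trans (cong (λ q → ∣ tabulate h ∣ + ∣ q ∣) (tabulate-∘ not h)) (∣p∣+∣∁p∣≡n (tabulate h))

colouring-cover : ∀ {m} k (f g : ℕ → Bool) →
  (∀ x → x < suc m →
    (f x ∨ f ((x + 1) % suc m) ≡ true) × (f x ∨ g x ≡ true) × (g x ∨ g ((x + k) % suc m) ≡ true)) →
  IsVertexCover (suc m) k (tabulate (f ∘ toℕ) , tabulate (g ∘ toℕ))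
colouring-cover {m} k f g ok = Equivalence.from (cover⇔ _ _) λ i →
  let (o , s , r) = ok (toℕ i) (toℕ<n i) in
  ∨-cong (at f i) (near f i 1) o , ∨-cong (at f i) (at g i) s , ∨-cong (at g i) (near g i k) r
  where
  at : ∀ (h : ℕ → Bool) i → lookup (tabulate (h ∘ toℕ)) i ≡ h (toℕ i)
  at h i = lookup∘tabulate (h ∘ toℕ) i
  near : ∀ (h : ℕ → Bool) (i : Fin (suc m)) j → lookup (tabulate (h ∘ toℕ)) (i ⊕ j) ≡ h ((toℕ i + j) % suc m)
  near h i j = trans (at h (i ⊕ j)) (cong h (toℕ-pos (toℕ i + j)))

-- For n even and k odd, u_i for odd i and v_i for even i is an exact cover (P(n,k) is bipartite).
bipartite-cover : ∀ m k → odd (suc m) ≡ false → odd k ≡ true →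
  IsVertexCover (suc m) k (tabulate (odd ∘ toℕ) , tabulate (not ∘ odd ∘ toℕ))
bipartite-cover m k even-n odd-k = colouring-cover k odd (not ∘ odd) λ x _ →
  ∨-cong refl (shift x 1 refl) (∨-inverseʳ (odd x)) ,
  ∨-inverseʳ (odd x) ,
  ∨-cong refl (cong not (shift x k odd-k)) (∨-inverseʳ (not (odd x)))
  where
  shift : ∀ x j → odd j ≡ true → odd ((x + j) % suc m) ≡ not (odd x)
  shift x j odd-j = trans (odd-mod-even even-n (x + j)) (trans (odd-+ x j) (cong (_xor odd x) odd-j))

-- Hence β(P(n,k)) ≤ n in the bipartite case, and β = n + 1 is impossible there.
bipartite-excluded : ∀ m k → VertexCoverNumber (suc m) k (suc m + 1) → odd (suc m) ≡ false → odd k ≡ true → ⊥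
bipartite-excluded m k (_ , minimal) even-n odd-k = 1+n≰n (subst₂ _≤_ (+-comm (suc m) 1)
  (∣tab∣+∣tab-not∣≡n (odd ∘ toℕ)) (minimal _ (bipartite-cover m k even-n odd-k)))

-- The prism P(n,1): u_i for even i, v_i for odd i, and both ends of the spoke at 0.
prism-u prism-v : ℕ → Bool
prism-u zero = true
prism-u (suc x) = odd x
prism-v zero = true
prism-v (suc x) = not (odd x)

prism-cover : ∀ m → IsVertexCover (suc m) 1 (tabulate (prism-u ∘ toℕ) , tabulate (prism-v ∘ toℕ))
prism-cover m = colouring-cover 1 prism-u prism-v λ x x<n →
  around prism-u u-step refl x x<n , spoke x , around prism-v v-step refl x x<n
  where
  u-step : ∀ x → prism-u x ∨ prism-u (suc x) ≡ true
  u-step zero = refl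
  u-step (suc x) = ∨-inverseʳ (odd x)
  v-step : ∀ x → prism-v x ∨ prism-v (suc x) ≡ true
  v-step zero = refl
  v-step (suc x) = ∨-inverseʳ (not (odd x))
  spoke : ∀ x → prism-u x ∨ prism-v x ≡ true
  spoke zero = refl
  spoke (suc x) = ∨-inverseʳ (odd x)
  next : ∀ x → x < suc m → (x + 1) % suc m ≡ suc x ⊎ (x + 1) % suc m ≡ 0
  next x x<n with m≤n⇒m<n∨m≡n x<n
  ... | inj₁ x+1<n = inj₁ (trans (cong (_% suc m) (+-comm x 1)) (m<n⇒m%n≡m x+1<n))
  ... | inj₂ x+1≡n = inj₂ (trans (cong (_% suc m) (trans (+-comm x 1) x+1≡n)) (n%n≡0 (suc m)))
  around : ∀ (h : ℕ → Bool) → (∀ x → h x ∨ h (suc x) ≡ true) → h 0 ≡ true →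
    ∀ x → x < suc m → h x ∨ h ((x + 1) % suc m) ≡ true
  around h step h0 x x<n with next x x<n
  ... | inj₁ e = ∨-cong refl (cong h e) (step x)
  ... | inj₂ e = ∨-cong refl (trans (cong h e) h0) (∨-zeroʳ (h x))

-- The prism cover doubles only the spoke at 0.
prism-size : ∀ m → size {suc m} (tabulate (prism-u ∘ toℕ) , tabulate (prism-v ∘ toℕ)) ≡ suc m + 1
prism-size m = begin
  1 + (∣ p ∣ + (1 + ∣ q ∣))   ≡⟨ cong (1 +_) (+-suc ∣ p ∣ ∣ q ∣) ⟩
  2 + (∣ p ∣ + ∣ q ∣)         ≡⟨ cong (2 +_) (∣tab∣+∣tab-not∣≡n (odd ∘ toℕ)) ⟩
  2 + m                       ≡⟨ cong (1 +_) (+-comm 1 m) ⟩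
  suc m + 1                   ∎
  where
  open ≡-Reasoning
  p q : Subset m
  p = tabulate (odd ∘ toℕ)
  q = tabulate (not ∘ odd ∘ toℕ)

petersen-U petersen-V : Subset 5
petersen-U = false ∷ true ∷ false ∷ true ∷ true ∷ []
petersen-V = true ∷ true ∷ true ∷ false ∷ false ∷ []

petersen-cover : IsVertexCover 5 2 (petersen-U , petersen-V)
petersen-cover = Equivalence.from (cover⇔ petersen-U petersen-V) λ
  { zero → refl , refl , refl
  ; (suc zero) → refl , refl , refl
  ; (suc (suc zero)) → refl , refl , refl
  ; (suc (suc (suc zero))) → refl , refl , refl
  ; (suc (suc (suc (suc zero)))) → refl , refl , refl }

-- Six of the edge constraints on the outer cycle a b c d e of P(5,2) under an exact cover.
pentagon : ∀ a b c d e → a ∨ b ≡ true → c ∨ d ≡ true → e ∨ a ≡ true →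
  not a ∨ not c ≡ true → not d ∨ not a ≡ true → not e ∨ not b ≡ true → ⊥
pentagon true _ true _ _ _ _ _ () _ _
pentagon true _ false true _ _ _ _ _ () _
pentagon true _ false false _ _ () _ _ _ _
pentagon false false _ _ _ () _ _ _ _ _
pentagon false true _ _ false _ _ () _ _ _
pentagon false true _ _ true _ _ _ _ _ ()

petersen-no-exact : ∀ U V → IsVertexCover 5 2 (U , V) → Exact U V → ⊥
petersen-no-exact U@(a ∷ b ∷ c ∷ d ∷ e ∷ []) V cov exact =
  pentagon a b c d e (outer 0) (outer 2) (outer 4) (co-inner 0) (co-inner 3) (co-inner 4)
  where
  open CyclicCover U V cov
  co-inner : ∀ x → not (U at x) ∨ not (U at (x + 2)) ≡ true
  co-inner x = ∨-cong (sym (exact (pos x))) (sym (exact (pos (x + 2)))) (inner x)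

-- An exact cover of the prism P(n,1) alternates around the outer n-cycle, impossible for n odd.
odd-prism-no-exact : ∀ m → odd (suc m) ≡ true → ∀ U V → IsVertexCover (suc m) 1 (U , V) → Exact U V → ⊥
odd-prism-no-exact m odd-n U V cov exact = not-¬ refl (begin
  U at 0                     ≡⟨ at-periodic U 0 ⟨
  U at suc m                 ≡⟨ parity (suc m) ⟩
  odd (suc m) xor U at 0     ≡⟨ cong (_xor U at 0) odd-n ⟩
  not (U at 0)               ∎)
  where
  open ≡-Reasoning
  open CyclicCover U V cov
  flips : ∀ x → U at suc x ≡ not (U at x)
  flips x = alternate (outer x)
    (∨-cong (sym (exact (pos x))) (trans (cong (λ t → not (U at t)) (+-comm 1 x)) (sym (exact (pos (x + 1)))))
      (inner x))
  parity : ∀ x → U at x ≡ odd x xor U at 0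
  parity zero = refl
  parity (suc x) = trans (flips x) (trans (cong not (parity x)) (not-distribˡ-xor (odd x) (U at 0)))

-- Let spoke i₀ be the only doubled one and w j = [u_{i₀+j} ∈ C] for 1 ≤ j ≤ N-1.  The outer
-- path u_{i₀+1} … u_{i₀+N-1} is covered by U; every other spoke is exact, so an inner edge
-- v_a v_b avoiding v_{i₀} must not have both u_a, u_b in C.  Such an inner edge stays on the
-- path (j, j + K) or wraps around it (a, b with a + K = N + b).
record PathConstraints (N K : ℕ) (w : ℕ → Bool) : Set where
  field
    outer : ∀ j → 1 ≤ j → suc j < N → w j ∨ w (suc j) ≡ true
    inner : ∀ j → 1 ≤ j → j + K < N → not (w j) ∨ not (w (j + K)) ≡ true
    wrap  : ∀ a b → 1 ≤ a → a < N → 1 ≤ b → a + K ≡ N + b → not (w a) ∨ not (w b) ≡ true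

-- Two outer edges ab, cd joined by inner edges ac, bd force b = not a and c = b.
square : ∀ a b c d → a ∨ b ≡ true → c ∨ d ≡ true → not a ∨ not c ≡ true → not b ∨ not d ≡ true →
  b ≡ not a × c ≡ b
square true false false _ _ _ _ _ = refl , refl
square true false true _ _ _ () _
square false true true _ _ _ _ _ = refl , refl
square false true false true _ _ _ ()
square false true false false _ () _ _
square true true true _ _ _ () _
square true true false true _ _ _ ()
square true true false false _ () _ _
square false false _ _ () _ _ _

module PathAnalysis {N K w} (pc : PathConstraints N K w) where
  open PathConstraints pc

  square-at : ∀ j → 1 ≤ j → suc j + K < N → w (suc j) ≡ not (w j) × w (j + K) ≡ w (suc j)
  square-at j 1≤j lt = square (w j) (w (suc j)) (w (j + K)) (w (suc (j + K)))
    (outer j 1≤j (≤-trans (s≤s (m≤m+n (suc j) K)) lt))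
    (outer (j + K) (≤-trans 1≤j (m≤m+n j K)) lt)
    (inner j 1≤j (<⇒≤ lt))
    (inner (suc j) (s≤s z≤n) lt)

  alternates : ∀ d → suc d + K < N → w (suc d) ≡ odd d xor w 1
  alternates zero _ = refl
  alternates (suc d) lt = trans (proj₁ (square-at (suc d) (s≤s z≤n) lt))
    (trans (cong not (alternates d (<⇒≤ lt))) (not-distribˡ-xor (odd d) (w 1)))

  shifted : ∀ j → 1 ≤ j → suc j + K < N → w (j + K) ≡ odd j xor w 1
  shifted j 1≤j lt = trans (proj₂ (square-at j 1≤j lt)) (alternates j lt)

-- For even K the two descriptions of w (K + 1) disagree as soon as N ≥ 2K + 2.
even-impossible : ∀ {N K w} → PathConstraints N K w → 1 ≤ K → odd K ≡ false → suc (2 * K) < N → ⊥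
even-impossible {N} {K} {w} pc 1≤K even-K lt = not-¬ refl (begin
  w 1              ≡⟨ cong (_xor w 1) even-K ⟨
  odd K xor w 1    ≡⟨ alternates K lt′ ⟨
  w (suc K)        ≡⟨ shifted 1 (s≤s z≤n) (≤-<-trans (s≤s (+-monoˡ-≤ K 1≤K)) lt′) ⟩
  not (w 1)        ∎)
  where
  open ≡-Reasoning
  open PathAnalysis pc
  lt′ : suc K + K < N
  lt′ = subst (λ t → suc t < N) (cong (K +_) (+-identityʳ K)) lt

-- The end of the path, w(N-2) = x and w(N-1) = y, against w(K-2) = x and w(K-1) = not x.
wrap-clash : ∀ x y → not x ∨ not x ≡ true → x ∨ y ≡ true → not y ∨ not (not x) ≡ true → ⊥
wrap-clash true _ () _ _
wrap-clash false false _ () _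
wrap-clash false true _ _ ()

-- With K = b + 3 and N = j + K + 2 where j and b have equal parity, the wrap-around edges at
-- the end of the path contradict the alternation at its start.
odd-wrap-impossible : ∀ b j {w} → PathConstraints (suc (suc (j + (3 + b)))) (3 + b) w →
  suc b < j → odd j ≡ odd b → ⊥
odd-wrap-impossible b j {w} pc b<j same-parity = wrap-clash x (w (suc (j + K)))
  (∨-cong (cong not (sym end)) (cong not (sym start₁))
    (wrap (j + K) (suc b) 1≤j+K (m<n⇒m<1+n (n<1+n (j + K))) (s≤s z≤n)
      (trans (+-suc (j + K) (2 + b)) (cong (1 +_) (+-suc (j + K) (1 + b))))))
  (∨-cong (sym end) refl (outer (j + K) 1≤j+K ≤-refl))
  (∨-cong refl (cong not (sym start₂))
    (wrap (suc (j + K)) (suc (suc b)) (s≤s z≤n) ≤-refl (s≤s z≤n) (cong (1 +_) (+-suc (j + K) (2 + b)))))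
  where
  open PathConstraints pc
  open PathAnalysis pc
  K : ℕ
  K = 3 + b
  x : Bool
  x = odd b xor w 1
  1≤j : 1 ≤ j
  1≤j = ≤-trans (s≤s z≤n) b<j
  1≤j+K : 1 ≤ j + K
  1≤j+K = ≤-trans 1≤j (m≤m+n j K)
  start-bound : suc (suc b) + K < suc (suc (j + K))
  start-bound = s≤s (s≤s (+-monoˡ-≤ K (<⇒≤ b<j)))
  start₁ : w (suc b) ≡ x
  start₁ = alternates b (<⇒≤ start-bound)
  start₂ : w (suc (suc b)) ≡ not x
  start₂ = trans (alternates (suc b) start-bound) (sym (not-distribˡ-xor (odd b) (w 1)))
  end : w (j + K) ≡ x
  end = trans (shifted j 1≤j ≤-refl) (cong (_xor w 1) same-parity)

odd-impossible : ∀ {N K w} → PathConstraints N K w → 3 ≤ K → 2 * K < N → odd N ≡ true → ⊥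
odd-impossible {w = w} pc (s≤s (s≤s (s≤s (z≤n {b})))) lt odd-N with m≤n⇒∃[o]m+o≡n lt
... | r , refl = odd-wrap-impossible b j (subst (λ N → PathConstraints N (3 + b) w) (shape b r) pc)
  (s≤s (s≤s (m≤m+n b r))) same-parity
  where
  -- N = 2K + 1 + r = j + K + 2 with j = b + r + 2; N odd makes r even, so j ≡ b mod 2.
  j : ℕ
  j = 2 + (b + r)
  shape : ∀ b r → suc (2 * (3 + b)) + r ≡ suc (suc (2 + (b + r) + (3 + b)))
  shape = solve-∀
  even-r : odd r ≡ false
  even-r = trans (sym (not-involutive (odd r)))
    (cong not (trans (sym (cong not (odd-double+ (3 + b) r))) odd-N))
  same-parity : odd j ≡ odd b
  same-parity = trans (not-involutive (odd (b + r))) (trans (odd-+ b r) (cong (_xor odd b) even-r))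

classify : ∀ N K {w} → PathConstraints N K w → 2 ≤ K → 2 * K < N →
  (N ≡ 5 × K ≡ 2) ⊎ (odd N ≡ false × odd K ≡ true)
classify N 0 pc () lt
classify N 1 pc (s≤s ()) lt
classify N 2 pc _ lt with m≤n⇒m<n∨m≡n lt
... | inj₁ 5<N = ⊥-elim (even-impossible pc (s≤s z≤n) refl 5<N)
... | inj₂ 5≡N = inj₁ (sym 5≡N , refl)
classify N K@(suc (suc (suc _))) pc _ lt with odd N in odd-N | odd K in odd-K
... | true | _ = ⊥-elim (odd-impossible pc (s≤s (s≤s (s≤s z≤n))) lt odd-N)
... | false | true = inj₂ (refl , refl)
... | false | false with m≤n⇒m<n∨m≡n lt
...   | inj₁ 2K+1<N = ⊥-elim (even-impossible pc (s≤s z≤n) odd-K 2K+1<N)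
...   | inj₂ 2K+1≡N = -- N = 2K + 1 would be odd
  contradiction (trans (cong not (sym (odd-double K))) (trans (cong odd 2K+1≡N) odd-N)) λ ()

one-doubled : ∀ {n k} (U V : Subset n) → IsVertexCover n k (U , V) → size (U , V) ≡ n + 1 → ∣ U ∩ V ∣ ≡ 1
one-doubled {n} U V cov size≡ = +-cancelˡ-≡ n _ _ (trans (sym (cover-size U V cov)) size≡)

path-constraints : ∀ {m k} (U V : Subset (suc m)) → IsVertexCover (suc m) k (U , V) →
  ∣ U ∩ V ∣ ≡ 1 → k < suc m → ∃ (PathConstraints (suc m) k)
path-constraints {m} {k} U V cov doubled k<n = w , record
  { outer = path-outer ; inner = path-inner ; wrap = path-wrap }
  where
  open CyclicCover U V cov
  n : ℕ
  n = suc m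
  i₀-unique : Σ (Fin n) λ i₀ → i₀ ∈ U ∩ V × (∀ j → j ≢ i₀ → j ∉ U ∩ V)
  i₀-unique = ∣p∣≡1⇒singleton (U ∩ V) doubled
  i : ℕ
  i = toℕ (proj₁ i₀-unique)
  w : ℕ → Bool
  w j = U at (i + j)
  exact-off : ∀ j → 1 ≤ j → j < n → V at (i + j) ≡ not (w j)
  exact-off j 1≤j j<n = single-end U V (pos (i + j)) (spoke (i + j))
    (proj₂ (proj₂ i₀-unique) (pos (i + j)) (pos-offset-≢ (proj₁ i₀-unique) 1≤j j<n))
  path-outer : ∀ j → 1 ≤ j → suc j < n → w j ∨ w (suc j) ≡ true
  path-outer j _ _ = ∨-cong refl (cong (U at_) (+-suc i j)) (outer (i + j))
  path-inner : ∀ j → 1 ≤ j → j + k < n → not (w j) ∨ not (w (j + k)) ≡ true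
  path-inner j 1≤j lt = ∨-cong (sym (exact-off j 1≤j (≤-<-trans (m≤m+n j k) lt)))
    (trans (sym (exact-off (j + k) (≤-trans 1≤j (m≤m+n j k)) lt)) (cong (V at_) (sym (+-assoc i j k))))
    (inner (i + j))
  path-wrap : ∀ a b → 1 ≤ a → a < n → 1 ≤ b → a + k ≡ n + b → not (w a) ∨ not (w b) ≡ true
  path-wrap a b 1≤a a<n 1≤b eq = ∨-cong (sym (exact-off a 1≤a a<n)) (trans (sym (exact-off b 1≤b b<n)) far)
    (inner (i + a))
    where
    b<n : b < n
    b<n = +-cancelˡ-< n b n (subst (_< n + n) eq (+-mono-< a<n k<n))
    far : V at (i + b) ≡ V at (i + a + k)
    far = trans (sym (at-periodic V (i + b))) (cong (V at_) (begin
      i + b + n       ≡⟨ +-assoc i b n ⟩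
      i + (b + n)     ≡⟨ cong (i +_) (trans (+-comm b n) (sym eq)) ⟩
      i + (a + k)     ≡⟨ +-assoc i a k ⟨
      i + a + k       ∎))
      where open ≡-Reasoning

forward : ∀ n k → 1 ≤ k → 2 * k < n → VertexCoverNumber n k (n + 1) → (Odd n × k ≡ 1) ⊎ (n ≡ 5 × k ≡ 2)
forward zero _ _ () _
forward (suc m) 1 _ _ β with odd (suc m) in odd-n
... | true = inj₁ (Equivalence.from (Odd⇔odd (suc m)) odd-n , refl)
... | false = ⊥-elim (bipartite-excluded m 1 β odd-n refl)
forward (suc m) k@(suc (suc _)) _ lt β@(((U , V) , cov , size≡) , _)
  with path-constraints U V cov (one-doubled U V cov size≡) (≤-<-trans (m≤m+n k (k + 0)) lt)
... | w , pc with classify (suc m) k pc (s≤s (s≤s z≤n)) lt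
...   | inj₁ petersen = inj₂ petersen
...   | inj₂ (even-n , odd-k) = ⊥-elim (bipartite-excluded m k β even-n odd-k)

-- ⇐: the odd prisms and the Petersen graph have covers of size n + 1 but no exact cover.
backward : ∀ n k → (Odd n × k ≡ 1) ⊎ (n ≡ 5 × k ≡ 2) → VertexCoverNumber n k (n + 1)
backward zero _ (inj₁ (() , _))
backward (suc m) 1 (inj₁ (odd-n , refl)) = (_ , prism-cover m , prism-size m) ,
  no-exact⇒lower-bound (odd-prism-no-exact m (Equivalence.to (Odd⇔odd (suc m)) odd-n))
backward 5 2 (inj₂ (refl , refl)) = ((petersen-U , petersen-V) , petersen-cover , refl) ,
  no-exact⇒lower-bound petersen-no-exact

theorem15 : (n k : ℕ) → 1 ≤ k → 2 * k < n →
    VertexCoverNumber n k (n + 1) ⇔ ((Odd n × k ≡ 1) ⊎ (n ≡ 5 × k ≡ 2))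
theorem15 n k 1≤k 2k<n = mk⇔ (forward n k 1≤k 2k<n) (backward n k)
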